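{- Let $g:\mathbb{N}\to\mathbb{R}_{>0}$ with $g(1)=1$. Define $P_0(x)=1$, $P_n(x)=\frac{x}{n}\sum_{k=1}^{n}g(k)P_{n-k}(x)$ for $n\geq1$, and $\Delta_2(x)=(P_2(x))^{3}-(P_3(x))^{2}$. Then $\Delta_2(x)\geq0$ for all real $x\geq g(2)$ if and only if $g(3)\leq g(2)^2$. -}

module Defs where

open import Level using (0ℓ)
open import Data.Nat using (ℕ; zero; suc)
open import Data.List using (List; []; _∷_)
open import Data.Product using (Σ; ∃; _×_; _,_)
open import Relation.Binary.PropositionalEquality using (_≡_; _≢_)
open import Relation.Binary.Structures using (IsTotalOrder)
open import Algebra.Structures using (IsCommutativeRing)

-- The real numbers, axiomatised as a Dedekind-complete ordered field
-- (this determines ℝ up to unique isomorphism, classically).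
record Reals : Set₁ where
  infixl 6 _+_
  infixl 7 _*_
  infix 4 _≤_ _<_
  field
    ℝ     : Set
    0r 1r : ℝ
    _+_ _*_ : ℝ → ℝ → ℝ
    -_    : ℝ → ℝ
    _⁻¹   : ℝ → ℝ          -- multiplicative inverse (value at 0 irrelevant)
    _≤_   : ℝ → ℝ → Set
    isCommutativeRing : IsCommutativeRing {A = ℝ} _≡_ _+_ _*_ -_ 0r 1r
    0≢1      : 0r ≢ 1r
    inverseʳ : ∀ x → x ≢ 0r → x * (x ⁻¹) ≡ 1r
    isTotalOrder : IsTotalOrder {A = ℝ} _≡_ _≤_
    +-monoˡ-≤ : ∀ {x y} z → x ≤ y → x + z ≤ y + z
    *-nonneg  : ∀ {x y} → 0r ≤ x → 0r ≤ y → 0r ≤ x * y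
    complete : (S : ℝ → Set) → (∃ λ s → S s) → (∃ λ b → ∀ s → S s → s ≤ b) →
               ∃ λ u → (∀ s → S s → s ≤ u) × (∀ b → (∀ s → S s → s ≤ b) → u ≤ b)

  _<_ : ℝ → ℝ → Set
  x < y = (x ≤ y) × (x ≢ y)

  fromℕ : ℕ → ℝ
  fromℕ zero    = 0r
  fromℕ (suc n) = 1r + fromℕ n

  _^3 : ℝ → ℝ
  x ^3 = x * x * x

  _^2 : ℝ → ℝ
  x ^2 = x * x

module Poly (R : Reals) (g : ℕ → Reals.ℝ R) (x : Reals.ℝ R) where
  open Reals R

  sumFrom : ℕ → List ℝ → ℝ
  sumFrom k []       = 0r
  sumFrom k (p ∷ ps) = g k * p + sumFrom (suc k) ps

  -- Ps n = [P_n(x), P_{n-1}(x), …, P_0(x)]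
  Ps : ℕ → List ℝ
  Ps zero    = 1r ∷ []
  Ps (suc n) = (x * fromℕ (suc n) ⁻¹ * sumFrom 1 (Ps n)) ∷ Ps n

  P : ℕ → ℝ
  P n with Ps n
  ... | []    = 0r   -- never happens
  ... | p ∷ _ = p

  Δ₂ : ℝ
  Δ₂ = (P 2) ^3 + - ((P 3) ^2)

{-# OPTIONS --safe #-}
module Submission where

-- With a = g(2) and b = g(3), the recurrence gives 2P₂ = x(x + a) and 6P₃ = xW where
-- W = x(x + a) + 2ax + 2b, so that
--   72Δ₂ = 9(x(x + a))³ − 2(xW)² = x²((a² − b)Q₁ + (x − a)Q₂)
-- for two polynomials Q₁, Q₂ with positive coefficients. Hence Δ₂ ≥ 0 on x ≥ a as soon as
-- b ≤ a², while at x = a the sign of Δ₂ is that of a² − b.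

open import Defs
open import Data.Nat using (ℕ; _≥_)
open import Relation.Binary.PropositionalEquality using (_≡_)
open import Function.Bundles using (_⇔_)

open import Algebra.Bundles using (CommutativeSemiring; Ring)
open import Algebra.Structures using (IsCommutativeRing)
open import Level using (0ℓ)
open import Data.Nat using (zero; suc; s≤s; z≤n)
open import Data.Product using (_,_; proj₁)
open import Data.Sum using (inj₁; inj₂)
open import Function.Bundles using (mk⇔; Equivalence)
open import Relation.Binary.PropositionalEquality
  using (_≢_; refl; sym; trans; cong; cong₂; subst; subst₂; module ≡-Reasoning)
open import Relation.Binary.Structures using (IsTotalOrder)

module OrderedFieldProperties (R : Reals) where
  open Reals R
  open IsCommutativeRing isCommutativeRing
    using (isRing; isCommutativeSemiring; +-comm; +-identityˡ; +-identityʳ; *-assoc; *-comm;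
           *-identityˡ; *-identityʳ; zeroʳ; distribˡ; -‿inverseʳ)
  open IsTotalOrder isTotalOrder
    using (total) renaming (trans to ≤-trans; antisym to ≤-antisym)

  ring : Ring 0ℓ 0ℓ
  ring = record { isRing = isRing }

  commutativeSemiring : CommutativeSemiring 0ℓ 0ℓ
  commutativeSemiring = record { isCommutativeSemiring = isCommutativeSemiring }

  open import Algebra.Properties.Ring ring
    using (-‿distribˡ-*; -‿distribʳ-*; -‿involutive; //-rightDividesˡ; //-rightDividesʳ)
  open import Algebra.Properties.Semiring.Mult.TCOptimised
    (CommutativeSemiring.semiring commutativeSemiring)
    using (_×_; 1+×) public

  private variable x y z : ℝ

  0≤y+-x⇔x≤y : (0r ≤ y + - x) ⇔ (x ≤ y)
  0≤y+-x⇔x≤y {y} {x} = mk⇔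
    (λ p → subst₂ _≤_ (+-identityˡ x) (//-rightDividesˡ x y) (+-monoˡ-≤ x p))
    (λ p → subst₂ _≤_ (-‿inverseʳ x) refl (+-monoˡ-≤ (- x) p))

  +-monoʳ-≤ : ∀ z → x ≤ y → z + x ≤ z + y
  +-monoʳ-≤ {x} {y} z p = subst₂ _≤_ (+-comm x z) (+-comm y z) (+-monoˡ-≤ z p)

  +-mono-≤ : ∀ {x′ y′} → x ≤ y → x′ ≤ y′ → x + x′ ≤ y + y′
  +-mono-≤ {y = y} {x′} p q = ≤-trans (+-monoˡ-≤ x′ p) (+-monoʳ-≤ y q)

  +-cancelʳ-≤ : ∀ z → x + z ≤ y + z → x ≤ y
  +-cancelʳ-≤ {x} {y} z p =
    subst₂ _≤_ (//-rightDividesʳ z x) (//-rightDividesʳ z y) (+-monoˡ-≤ (- z) p)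

  +-cancelˡ-≤ : ∀ z → z + x ≤ z + y → x ≤ y
  +-cancelˡ-≤ {x} {y} z p = +-cancelʳ-≤ z (subst₂ _≤_ (+-comm z x) (+-comm z y) p)

  u+l≡v+r⇒v≤u⇔l≤r : ∀ {u v l r} → u + l ≡ v + r → (v ≤ u) ⇔ (l ≤ r)
  u+l≡v+r⇒v≤u⇔l≤r {u} {v} {l} {r} u+l≡v+r = mk⇔
    (λ v≤u → +-cancelˡ-≤ v (subst (v + l ≤_) u+l≡v+r (+-monoˡ-≤ l v≤u)))
    (λ l≤r → +-cancelʳ-≤ l (subst (v + l ≤_) (sym u+l≡v+r) (+-monoʳ-≤ v l≤r)))

  +-nonneg : 0r ≤ x → 0r ≤ y → 0r ≤ x + y
  +-nonneg p q = subst₂ _≤_ (+-identityʳ 0r) refl (+-mono-≤ p q)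

  x*x-nonneg : ∀ x → 0r ≤ x * x
  x*x-nonneg x with total 0r x
  ... | inj₁ 0≤x = *-nonneg 0≤x 0≤x
  ... | inj₂ x≤0 = subst (0r ≤_) (-x*-x≡x*x) (*-nonneg 0≤-x 0≤-x)
    where
    0≤-x : 0r ≤ - x
    0≤-x = subst₂ _≤_ (-‿inverseʳ x) (+-identityˡ (- x)) (+-monoˡ-≤ (- x) x≤0)
    -x*-x≡x*x : - x * - x ≡ x * x
    -x*-x≡x*x = trans (sym (-‿distribˡ-* x (- x)))
                  (trans (cong -_ (sym (-‿distribʳ-* x x))) (-‿involutive (x * x)))

  *-monoˡ-≤-nonneg : ∀ {z} → 0r ≤ z → x ≤ y → z * x ≤ z * y
  *-monoˡ-≤-nonneg {x} {y} {z} 0≤z x≤y = subst₂ _≤_ (+-identityˡ (z * x)) z[y-x]+zx≡zy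
      (+-monoˡ-≤ (z * x) (*-nonneg 0≤z (Equivalence.from 0≤y+-x⇔x≤y x≤y)))
    where
    z[y-x]+zx≡zy : z * (y + - x) + z * x ≡ z * y
    z[y-x]+zx≡zy = trans (sym (distribˡ z (y + - x) x)) (cong (z *_) (//-rightDividesˡ x y))

  *-monoʳ-≤-nonneg : ∀ {z} → 0r ≤ z → x ≤ y → x * z ≤ y * z
  *-monoʳ-≤-nonneg {x} {y} {z} 0≤z x≤y =
    subst₂ _≤_ (*-comm z x) (*-comm z y) (*-monoˡ-≤-nonneg 0≤z x≤y)

  pos⇒≢0 : 0r < x → x ≢ 0r
  pos⇒≢0 (_ , 0≢x) = λ x≡0 → 0≢x (sym x≡0)

  ⁻¹-*-cancelˡ : x ≢ 0r → ∀ y → x ⁻¹ * (x * y) ≡ y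
  ⁻¹-*-cancelˡ {x} x≢0 y = begin
    x ⁻¹ * (x * y)  ≡⟨ sym (*-assoc (x ⁻¹) x y) ⟩
    x ⁻¹ * x * y    ≡⟨ cong (_* y) (trans (*-comm (x ⁻¹) x) (inverseʳ x x≢0)) ⟩
    1r * y          ≡⟨ *-identityˡ y ⟩
    y               ∎
    where open ≡-Reasoning

  ⁻¹-nonneg : 0r < x → 0r ≤ x ⁻¹
  ⁻¹-nonneg {x} 0<x@(0≤x , _) = subst (0r ≤_) x[x⁻¹x⁻¹]≡x⁻¹ (*-nonneg 0≤x (x*x-nonneg (x ⁻¹)))
    where
    x[x⁻¹x⁻¹]≡x⁻¹ : x * (x ⁻¹ * x ⁻¹) ≡ x ⁻¹
    x[x⁻¹x⁻¹]≡x⁻¹ = trans (sym (*-assoc x (x ⁻¹) (x ⁻¹)))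
      (trans (cong (_* x ⁻¹) (inverseʳ x (pos⇒≢0 0<x))) (*-identityˡ (x ⁻¹)))

  *-cancelˡ-≤-pos : ∀ {z} → 0r < z → z * x ≤ z * y → x ≤ y
  *-cancelˡ-≤-pos {x} {y} 0<z zx≤zy = subst₂ _≤_ (⁻¹-*-cancelˡ (pos⇒≢0 0<z) x)
    (⁻¹-*-cancelˡ (pos⇒≢0 0<z) y) (*-monoˡ-≤-nonneg (⁻¹-nonneg 0<z) zx≤zy)

  *-cancelʳ-≤-pos : ∀ {z} → 0r < z → x * z ≤ y * z → x ≤ y
  *-cancelʳ-≤-pos {x} {y} {z} 0<z xz≤yz =
    *-cancelˡ-≤-pos 0<z (subst₂ _≤_ (*-comm x z) (*-comm y z) xz≤yz)

  *-monoˡ-≤⇔-pos : ∀ {z} → 0r < z → (z * x ≤ z * y) ⇔ (x ≤ y)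
  *-monoˡ-≤⇔-pos 0<z = mk⇔ (*-cancelˡ-≤-pos 0<z) (*-monoˡ-≤-nonneg (proj₁ 0<z))

  <-≤-trans : x < y → y ≤ z → x < z
  <-≤-trans (x≤y , x≢y) y≤z =
    ≤-trans x≤y y≤z , λ { refl → x≢y (≤-antisym x≤y y≤z) }

  +-pos : 0r < x → 0r < y → 0r < x + y
  +-pos {x} {y} (0≤x , 0≢x) (0≤y , _) = +-nonneg 0≤x 0≤y , λ 0≡x+y →
    0≢x (≤-antisym 0≤x (subst₂ _≤_ (+-identityʳ x) (sym 0≡x+y) (+-monoʳ-≤ x 0≤y)))

  *-pos : 0r < x → 0r < y → 0r < x * y
  *-pos {x} {y} 0<x (0≤y , 0≢y) = *-nonneg (proj₁ 0<x) 0≤y , λ 0≡xy →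
    0≢y (trans (sym (zeroʳ (x ⁻¹))) (trans (cong (x ⁻¹ *_) 0≡xy) (⁻¹-*-cancelˡ (pos⇒≢0 0<x) y)))

  0<1 : 0r < 1r
  0<1 = subst (0r ≤_) (*-identityʳ 1r) (x*x-nonneg 1r) , 0≢1

  ×1-pos : ∀ n → 0r < suc n × 1r
  ×1-pos zero    = 0<1
  ×1-pos (suc n) = subst (0r <_) (sym (1+× (suc n) 1r)) (+-pos 0<1 (×1-pos n))

  fromℕ≡×1 : ∀ n → fromℕ n ≡ n × 1r
  fromℕ≡×1 zero    = refl
  fromℕ≡×1 (suc n) = trans (cong (1r +_) (fromℕ≡×1 n)) (sym (1+× n 1r))

module Polynomials (R : Reals) where
  open Reals R
  open OrderedFieldProperties R
  open import Algebra.Solver.Ring.NaturalCoefficients.Default commutativeSemiring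

  W : ℝ → ℝ → ℝ → ℝ
  W x a b = x * (x + a) + 2 × 1r * a * x + 2 × 1r * b

  Q₁ : ℝ → ℝ → ℝ → ℝ
  Q₁ x a b = 8 × 1r * (x * x + 3 × 1r * a * x + a * a + b)

  Q₂ : ℝ → ℝ → ℝ
  Q₂ x a = 7 × 1r * x * x * x + 22 × 1r * a * x * x + 23 × 1r * a * a * x + 8 × 1r * a * a * a

  -- 9(x(x + a))³ − 2(xW)² = x²((a² − b)Q₁ + (x − a)Q₂), rearranged without subtraction so that
  -- it is a semiring identity.
  key-identity : ∀ x a b →
    9 × 1r * (x * (x + a)) ^3 + x ^2 * (b * Q₁ x a b + a * Q₂ x a) ≡
    2 × 1r * (x * W x a b) ^2 + x ^2 * (a ^2 * Q₁ x a b + x * Q₂ x a)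
  key-identity = solve 3 (λ x a b →
    let u  = x :* (x :+ a)
        w  = x :* (x :+ a) :+ con 2 :* a :* x :+ con 2 :* b
        q₁ = con 8 :* (x :* x :+ con 3 :* a :* x :+ a :* a :+ b)
        q₂ = con 7 :* x :* x :* x :+ con 22 :* a :* x :* x :+ con 23 :* a :* a :* x
             :+ con 8 :* a :* a :* a
    in con 9 :* (u :* u :* u) :+ x :* x :* (b :* q₁ :+ a :* q₂)
       := con 2 :* ((x :* w) :* (x :* w)) :+ x :* x :* (a :* a :* q₁ :+ x :* q₂)) refl

  Q₁-pos : ∀ {x a b} → 0r < x → 0r < a → 0r < b → 0r < Q₁ x a b
  Q₁-pos x>0 a>0 b>0 = *-pos (×1-pos 7)
    (+-pos (+-pos (+-pos (*-pos x>0 x>0) (*-pos (*-pos (×1-pos 2) a>0) x>0)) (*-pos a>0 a>0)) b>0)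

  Q₂-pos : ∀ {x a} → 0r < x → 0r < a → 0r < Q₂ x a
  Q₂-pos x>0 a>0 = +-pos (+-pos (+-pos
    (*-pos (*-pos (*-pos (×1-pos 6) x>0) x>0) x>0)
    (*-pos (*-pos (*-pos (×1-pos 21) a>0) x>0) x>0))
    (*-pos (*-pos (*-pos (×1-pos 22) a>0) a>0) x>0))
    (*-pos (*-pos (*-pos (×1-pos 7) a>0) a>0) a>0)

module Recurrence (R : Reals) (g : ℕ → Reals.ℝ R) (x : Reals.ℝ R) where
  open Reals R
  open Poly R g x
  open OrderedFieldProperties R
  open IsCommutativeRing isCommutativeRing using (*-identityˡ)
  open import Algebra.Solver.Ring.NaturalCoefficients.Default commutativeSemiring

  ×1*P-suc≡x*sumFrom : ∀ n → suc n × 1r * P (suc n) ≡ x * sumFrom 1 (Ps n)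
  ×1*P-suc≡x*sumFrom n = begin
    c * (x * fromℕ (suc n) ⁻¹ * s)  ≡⟨ cong (λ d → c * (x * d ⁻¹ * s)) (fromℕ≡×1 (suc n)) ⟩
    c * (x * c ⁻¹ * s)              ≡⟨ solve 4 (λ c c⁻¹ x s → c :* (x :* c⁻¹ :* s)
                                                          := c :* c⁻¹ :* (x :* s)) refl c (c ⁻¹) x s ⟩
    c * c ⁻¹ * (x * s)              ≡⟨ cong (_* (x * s)) (inverseʳ c (pos⇒≢0 (×1-pos n))) ⟩
    1r * (x * s)                    ≡⟨ *-identityˡ (x * s) ⟩
    x * s                           ∎
    where
    open ≡-Reasoning
    c = suc n × 1r
    s = sumFrom 1 (Ps n)

module Criterion (R : Reals) (g : ℕ → Reals.ℝ R) (g₁≡1 : g 1 ≡ Reals.1r R) where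
  open Reals R
  open OrderedFieldProperties R
  open Polynomials R
  open IsCommutativeRing isCommutativeRing using (*-identityˡ)
  open import Algebra.Solver.Ring.NaturalCoefficients.Default commutativeSemiring
  open import Function.Related.Propositional using (module EquationalReasoning; equivalence)
  import Function.Properties.Equivalence as ⇔

  a b : ℝ
  a = g 2
  b = g 3

  module _ (x : ℝ) where
    open Poly R g x
    open Recurrence R g x

    P₁≡x : P 1 ≡ x
    P₁≡x = begin
      P 1                  ≡⟨ sym (*-identityˡ (P 1)) ⟩
      1 × 1r * P 1         ≡⟨ ×1*P-suc≡x*sumFrom 0 ⟩
      x * (g 1 * 1r + 0r)  ≡⟨ cong (λ c → x * (c * 1r + 0r)) g₁≡1 ⟩
      x * (1r * 1r + 0r)   ≡⟨ solve 1 (λ x → x :* (con 1 :* con 1 :+ con 0) := x) refl x ⟩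
      x                    ∎
      where open ≡-Reasoning

    2P₂≡x[x+a] : 2 × 1r * P 2 ≡ x * (x + a)
    2P₂≡x[x+a] = begin
      2 × 1r * P 2                     ≡⟨ ×1*P-suc≡x*sumFrom 1 ⟩
      x * (g 1 * P 1 + (a * 1r + 0r))  ≡⟨ cong₂ (λ c p → x * (c * p + (a * 1r + 0r))) g₁≡1 P₁≡x ⟩
      x * (1r * x + (a * 1r + 0r))     ≡⟨ solve 2 (λ x a → x :* (con 1 :* x :+ (a :* con 1 :+ con 0))
                                                          := x :* (x :+ a)) refl x a ⟩
      x * (x + a)                      ∎
      where open ≡-Reasoning

    6P₃≡x*W : 6 × 1r * P 3 ≡ x * W x a b
    6P₃≡x*W = begin
      6 × 1r * P 3
        ≡⟨ solve 1 (λ p → con 6 :* p := con 2 :* (con 3 :* p)) refl (P 3) ⟩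
      2 × 1r * (3 × 1r * P 3)
        ≡⟨ cong (2 × 1r *_) (×1*P-suc≡x*sumFrom 2) ⟩
      2 × 1r * (x * (g 1 * P 2 + (a * P 1 + (b * 1r + 0r))))
        ≡⟨ cong₂ (λ c p → 2 × 1r * (x * (c * P 2 + (a * p + (b * 1r + 0r))))) g₁≡1 P₁≡x ⟩
      2 × 1r * (x * (1r * P 2 + (a * x + (b * 1r + 0r))))
        ≡⟨ solve 4 (λ x a b p → con 2 :* (x :* (con 1 :* p :+ (a :* x :+ (b :* con 1 :+ con 0))))
                                 := x :* (con 2 :* p :+ con 2 :* a :* x :+ con 2 :* b)) refl x a b (P 2) ⟩
      x * (2 × 1r * P 2 + 2 × 1r * a * x + 2 × 1r * b)
        ≡⟨ cong (λ u → x * (u + 2 × 1r * a * x + 2 × 1r * b)) 2P₂≡x[x+a] ⟩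
      x * W x a b
        ∎
      where open ≡-Reasoning

    72P₂³≡9[x[x+a]]³ : 72 × 1r * P 2 ^3 ≡ 9 × 1r * (x * (x + a)) ^3
    72P₂³≡9[x[x+a]]³ = begin
      72 × 1r * P 2 ^3
        ≡⟨ solve 1 (λ p → con 72 :* (p :* p :* p)
                           := con 9 :* ((con 2 :* p) :* (con 2 :* p) :* (con 2 :* p))) refl (P 2) ⟩
      9 × 1r * (2 × 1r * P 2) ^3  ≡⟨ cong (λ u → 9 × 1r * u ^3) 2P₂≡x[x+a] ⟩
      9 × 1r * (x * (x + a)) ^3   ∎
      where open ≡-Reasoning

    72P₃²≡2[xW]² : 72 × 1r * P 3 ^2 ≡ 2 × 1r * (x * W x a b) ^2
    72P₃²≡2[xW]² = begin
      72 × 1r * P 3 ^2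
        ≡⟨ solve 1 (λ p → con 72 :* (p :* p) := con 2 :* ((con 6 :* p) :* (con 6 :* p))) refl (P 3) ⟩
      2 × 1r * (6 × 1r * P 3) ^2  ≡⟨ cong (λ v → 2 × 1r * v ^2) 6P₃≡x*W ⟩
      2 × 1r * (x * W x a b) ^2   ∎
      where open ≡-Reasoning

    0≤Δ₂-criterion : 0r < x →
      (0r ≤ Δ₂) ⇔ (b * Q₁ x a b + a * Q₂ x a ≤ a ^2 * Q₁ x a b + x * Q₂ x a)
    0≤Δ₂-criterion x>0 = begin
      0r ≤ P 2 ^3 + - (P 3 ^2)
        ∼⟨ 0≤y+-x⇔x≤y ⟩
      P 3 ^2 ≤ P 2 ^3
        ∼⟨ ⇔.sym (*-monoˡ-≤⇔-pos (×1-pos 71)) ⟩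
      72 × 1r * P 3 ^2 ≤ 72 × 1r * P 2 ^3
        ≡⟨ cong₂ _≤_ 72P₃²≡2[xW]² 72P₂³≡9[x[x+a]]³ ⟩
      2 × 1r * (x * W x a b) ^2 ≤ 9 × 1r * (x * (x + a)) ^3
        ∼⟨ u+l≡v+r⇒v≤u⇔l≤r (key-identity x a b) ⟩
      x ^2 * (b * Q₁ x a b + a * Q₂ x a) ≤ x ^2 * (a ^2 * Q₁ x a b + x * Q₂ x a)
        ∼⟨ *-monoˡ-≤⇔-pos (*-pos x>0 x>0) ⟩
      b * Q₁ x a b + a * Q₂ x a ≤ a ^2 * Q₁ x a b + x * Q₂ x a
        ∎
      where open EquationalReasoning {k = equivalence}

lemma2p3 : (R : Reals) → let open Reals R in
           (g : ℕ → ℝ) → (∀ k → k ≥ 1 → 0r < g k) → g 1 ≡ 1r →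
           ((∀ x → g 2 ≤ x → 0r ≤ Poly.Δ₂ R g x) ⇔ (g 3 ≤ (g 2) ^2))
lemma2p3 R g g-pos g₁≡1 = mk⇔
  (λ 0≤Δ₂ → *-cancelʳ-≤-pos (Q₁-pos a>0 a>0 b>0)
     (+-cancelʳ-≤ (a * Q₂ a a) (Equivalence.to (0≤Δ₂-criterion a a>0) (0≤Δ₂ a ≤-refl))))
  (λ b≤a² x a≤x → let x>0 = <-≤-trans a>0 a≤x in
     Equivalence.from (0≤Δ₂-criterion x x>0)
       (+-mono-≤ (*-monoʳ-≤-nonneg (proj₁ (Q₁-pos x>0 a>0 b>0)) b≤a²)
                 (*-monoʳ-≤-nonneg (proj₁ (Q₂-pos x>0 a>0)) a≤x)))
  where
  open Reals R
  open OrderedFieldProperties R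
  open Polynomials R
  open Criterion R g g₁≡1
  open IsTotalOrder isTotalOrder using () renaming (refl to ≤-refl)

  a>0 : 0r < a
  a>0 = g-pos 2 (s≤s z≤n)

  b>0 : 0r < b
  b>0 = g-pos 3 (s≤s z≤n)
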